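{- Let $\delta=10\in\mathbb{F}_{17}$ and let $\alpha\in\mathbb{F}_{17^2}$ be a root of $x^2-\delta$. Let $H=\{1,4,5\}$ and $C_{17}^B=\{0\}\cup H\cup 10(\alpha+6)H\cup\{10(\alpha+3),\,6(\alpha+9)\}$. For $s\in S$, $\gamma\in\mathbb{F}_{17^2}$ put $C_{s,\gamma}=\{sx+\gamma : x\in C_{17}^B\}$. Then the orbit of $C_{17}^B$ under $\mathrm{Aut}(P(17^2))$ equals $\{C_{s,\gamma} : s\in S,\ \gamma\in\mathbb{F}_{17^2}\}$.
   Context: $S$ is the set of nonzero squares of $\mathbb{F}_{17^2}$. The Paley graph $P(17^2)$ has vertex set $\mathbb{F}_{17^2}$, two distinct vertices adjacent iff their difference lies in $S$. $\mathrm{Aut}(P(17^2))=\{\gamma\mapsto a\gamma^{v}+b : a\in S,\ b\in\mathbb{F}_{17^2},\ v\in\mathrm{Gal}(\mathbb{F}_{17^2})\}$, acting on subsets elementwise. Elements of $\mathbb{F}_{17}$ are written as integers mod $17$. -}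

module Defs where

open import Data.Nat using (ℕ)
open import Data.Nat.DivMod using (_mod_)
open import Data.Fin using (Fin; toℕ)
open import Data.Product using (Σ; _×_; _,_; ∃)
open import Data.List using (List; _∷_; []; map)
open import Data.List.Membership.Propositional using (_∈_)
open import Relation.Binary.PropositionalEquality using (_≡_)
open import Relation.Nullary using (¬_)
open import Function.Bundles using (_⇔_)
open import Function.Definitions using (Bijective)

F17 : Set
F17 = Fin 17

infixl 6 _+₁₇_
infixl 7 _*₁₇_

_+₁₇_ : F17 → F17 → F17
a +₁₇ b = (toℕ a Data.Nat.+ toℕ b) mod 17

_*₁₇_ : F17 → F17 → F17
a *₁₇ b = (toℕ a Data.Nat.* toℕ b) mod 17

-- δ = 10 ∈ F_17 (a non-square mod 17)
δ : F17
δ = 10 mod 17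

-- F_{17^2} = F_17[x]/(x² − δ); the pair (a , b) stands for a + b·α,
-- where α is the class of x, a root of x² − δ.

F289 : Set
F289 = F17 × F17

infixl 6 _+_
infixl 7 _*_

_+_ : F289 → F289 → F289
(a , b) + (c , d) = (a +₁₇ c , b +₁₇ d)

_*_ : F289 → F289 → F289
(a , b) * (c , d) = (a *₁₇ c +₁₇ δ *₁₇ (b *₁₇ d) , a *₁₇ d +₁₇ b *₁₇ c)

ι : ℕ → F289
ι n = (n mod 17 , 0 mod 17)

𝟘 𝟙 α : F289
𝟘 = ι 0
𝟙 = ι 1
α = (0 mod 17 , 1 mod 17)

S : F289 → Set
S x = (¬ x ≡ 𝟘) × (∃ λ y → y * y ≡ x)

IsGal : (F289 → F289) → Set
IsGal v = Bijective _≡_ _≡_ v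
        × (∀ x y → v (x + y) ≡ v x + v y)
        × (∀ x y → v (x * y) ≡ v x * v y)
        × (v 𝟙 ≡ 𝟙)

IsAut : (F289 → F289) → Set
IsAut σ = Σ F289 λ a → Σ F289 λ b → Σ (F289 → F289) λ v →
          S a × IsGal v × (∀ γ → σ γ ≡ a * v γ + b)

_≐_ : List F289 → List F289 → Set
A ≐ B = ∀ y → (y ∈ A) ⇔ (y ∈ B)

H : List F289
H = ι 1 ∷ ι 4 ∷ ι 5 ∷ []

CB : List F289
CB = 𝟘 ∷ Data.List._++_ H
       (Data.List._++_ (map (λ h → (ι 10 * (α + ι 6)) * h) H)
         (ι 10 * (α + ι 3) ∷ ι 6 * (α + ι 9) ∷ []))

C : F289 → F289 → List F289
C s γ = map (λ x → s * x + γ) CB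

-- The Galois group of F_{17²} is {id, conjugation}, since a field automorphism fixes the
-- prime field and sends α to a root of x² − δ, i.e. to ±α. For the identity the image of
-- C_17^B under γ ↦ aγ + b is C_{a,b}. For conjugation the key (finite) fact is that the
-- conjugate of C_17^B is −C_17^B + 5, so the image is C_{−a, 5a+b}, and −a ∈ S because
-- −1 = 4² is a square.
module Submission where

open import Defs
open import Algebra.Bundles using (CommutativeSemiring)
open import Algebra.Core using (Op₂)
open import Algebra.Definitions
  using (Associative; Commutative; LeftIdentity; LeftZero; _DistributesOverʳ_)
open import Algebra.Structures.Biased using (isCommutativeMonoidˡ; isCommutativeSemiringˡ)
import Algebra.Solver.Ring.NaturalCoefficients.Default as Solver
open import Data.Fin using (zero; suc; toℕ)
open import Data.Fin.Properties
  using (all?; toℕ<n; toℕ-fromℕ<; fromℕ<-cong; fromℕ<-toℕ) renaming (_≟_ to _≟₁₇_)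
open import Data.List using (List; map)
import Data.List.Membership.DecPropositional as DecMembership
open import Data.List.Properties using (map-cong; map-∘)
open import Data.List.Relation.Binary.BagAndSetEquality as SetEquality using (set)
open import Data.Nat using (zero; suc; _%_)
open import Data.Nat.DivMod using (_mod_; m%n<n; %-distribˡ-+; m<n⇒m%n≡m)
open import Data.Product using (Σ; _×_; _,_; proj₁; proj₂; uncurry)
open import Data.Product.Properties using (≡-dec)
open import Data.Sum using (_⊎_; inj₁; inj₂)
open import Data.Unit using (tt)
open import Function using (id)
open import Function.Bundles using (mk⇔; Equivalence)
open import Function.Construct.Identity using (bijective)
open import Relation.Binary.Definitions using (DecidableEquality)
open import Relation.Binary.PropositionalEquality
open import Relation.Binary.PropositionalEquality.Algebra using (isMagma)
open import Relation.Nullary using (Dec; ¬_)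
open import Relation.Nullary.Decidable using (toWitness; map′; _→-dec_; _×-dec_; _⊎-dec_)
open import Relation.Unary using (Decidable)

infix 4 _≟_

_≟_ : DecidableEquality F289
_≟_ = ≡-dec _≟₁₇_ _≟₁₇_

all-F289? : {P : F289 → Set} → Decidable P → Dec (∀ x → P x)
all-F289? P? = map′ (λ p x → p (proj₁ x) (proj₂ x)) (λ p a b → p (a , b))
  (all? λ a → all? λ b → P? (a , b))

_≐?_ : (A B : List F289) → Dec (A ≐ B)
A ≐? B = all-F289? λ y →
  map′ (uncurry mk⇔) (λ e → Equivalence.to e , Equivalence.from e)
    ((y ∈? A →-dec y ∈? B) ×-dec (y ∈? B →-dec y ∈? A))
  where open DecMembership _≟_ using (_∈?_)

≡⇒≐ : ∀ {A B} → A ≡ B → A ≐ B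
≡⇒≐ refl _ = mk⇔ id id

≐-map⁺ : ∀ (f : F289 → F289) {A B} → A ≐ B → map f A ≐ map f B
≐-map⁺ f A≐B y = SetEquality.map-cong {k = set} (λ _ → refl) (λ {x} → A≐B x) {y}

commutativeSemiring-≡ : ∀ {A : Set} (_⊕_ _⊗_ : Op₂ A) (0# 1# : A) →
  Associative _≡_ _⊕_ → Commutative _≡_ _⊕_ → LeftIdentity _≡_ 0# _⊕_ →
  Associative _≡_ _⊗_ → Commutative _≡_ _⊗_ → LeftIdentity _≡_ 1# _⊗_ →
  _DistributesOverʳ_ _≡_ _⊗_ _⊕_ → LeftZero _≡_ 0# _⊗_ → CommutativeSemiring _ _
commutativeSemiring-≡ _⊕_ _⊗_ 0# 1#
  ⊕-assoc ⊕-comm ⊕-identityˡ ⊗-assoc ⊗-comm ⊗-identityˡ distribʳ zeroˡ = record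
  { isCommutativeSemiring = isCommutativeSemiringˡ record
    { +-isCommutativeMonoid = isCommutativeMonoidˡ record
      { isSemigroup = record { isMagma = isMagma _⊕_ ; assoc = ⊕-assoc }
      ; identityˡ   = ⊕-identityˡ
      ; comm        = ⊕-comm
      }
    ; *-isCommutativeMonoid = isCommutativeMonoidˡ record
      { isSemigroup = record { isMagma = isMagma _⊗_ ; assoc = ⊗-assoc }
      ; identityˡ   = ⊗-identityˡ
      ; comm        = ⊗-comm
      }
    ; distribʳ = distribʳ
    ; zeroˡ    = zeroˡ
    }
  }

abstract
  +₁₇-assoc : Associative _≡_ _+₁₇_
  +₁₇-assoc = toWitness {a? = all? λ a → all? λ b → all? λ c →
    (a +₁₇ b) +₁₇ c ≟₁₇ a +₁₇ (b +₁₇ c)} tt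

  +₁₇-comm : Commutative _≡_ _+₁₇_
  +₁₇-comm = toWitness {a? = all? λ a → all? λ b → a +₁₇ b ≟₁₇ b +₁₇ a} tt

  +₁₇-identityˡ : LeftIdentity _≡_ zero _+₁₇_
  +₁₇-identityˡ = toWitness {a? = all? λ a → zero +₁₇ a ≟₁₇ a} tt

  *₁₇-assoc : Associative _≡_ _*₁₇_
  *₁₇-assoc = toWitness {a? = all? λ a → all? λ b → all? λ c →
    (a *₁₇ b) *₁₇ c ≟₁₇ a *₁₇ (b *₁₇ c)} tt

  *₁₇-comm : Commutative _≡_ _*₁₇_
  *₁₇-comm = toWitness {a? = all? λ a → all? λ b → a *₁₇ b ≟₁₇ b *₁₇ a} tt

  *₁₇-identityˡ : LeftIdentity _≡_ (suc zero) _*₁₇_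
  *₁₇-identityˡ = toWitness {a? = all? λ a → suc zero *₁₇ a ≟₁₇ a} tt

  *₁₇-distribʳ : _DistributesOverʳ_ _≡_ _*₁₇_ _+₁₇_
  *₁₇-distribʳ = toWitness {a? = all? λ c → all? λ a → all? λ b →
    (a +₁₇ b) *₁₇ c ≟₁₇ a *₁₇ c +₁₇ b *₁₇ c} tt

  *₁₇-zeroˡ : LeftZero _≡_ zero _*₁₇_
  *₁₇-zeroˡ = toWitness {a? = all? λ a → zero *₁₇ a ≟₁₇ zero} tt

F17-commutativeSemiring : CommutativeSemiring _ _
F17-commutativeSemiring = commutativeSemiring-≡ _+₁₇_ _*₁₇_ zero (suc zero)
  +₁₇-assoc +₁₇-comm +₁₇-identityˡ *₁₇-assoc *₁₇-comm *₁₇-identityˡ *₁₇-distribʳ *₁₇-zeroˡ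

expand : F289 → F289 → F289
expand w (a , b) = (a , zero) + (b , zero) * w

module _ where
  open Solver F17-commutativeSemiring

  +-assoc : Associative _≡_ _+_
  +-assoc (a , b) (c , d) (e , f) = cong₂ _,_ (+₁₇-assoc a c e) (+₁₇-assoc b d f)

  +-comm : Commutative _≡_ _+_
  +-comm (a , b) (c , d) = cong₂ _,_ (+₁₇-comm a c) (+₁₇-comm b d)

  +-identityˡ : LeftIdentity _≡_ 𝟘 _+_
  +-identityˡ (a , b) = cong₂ _,_ (+₁₇-identityˡ a) (+₁₇-identityˡ b)

  *-assoc : Associative _≡_ _*_
  *-assoc (a , b) (c , d) (e , f) = cong₂ _,_
    (solve 7 (λ a b c d e f δ →
       (a :* c :+ δ :* (b :* d)) :* e :+ δ :* ((a :* d :+ b :* c) :* f)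
       := a :* (c :* e :+ δ :* (d :* f)) :+ δ :* (b :* (c :* f :+ d :* e))) refl a b c d e f δ)
    (solve 7 (λ a b c d e f δ →
       (a :* c :+ δ :* (b :* d)) :* f :+ (a :* d :+ b :* c) :* e
       := a :* (c :* f :+ d :* e) :+ b :* (c :* e :+ δ :* (d :* f))) refl a b c d e f δ)

  *-comm : Commutative _≡_ _*_
  *-comm (a , b) (c , d) = cong₂ _,_
    (solve 5 (λ a b c d δ → a :* c :+ δ :* (b :* d) := c :* a :+ δ :* (d :* b)) refl a b c d δ)
    (solve 4 (λ a b c d → a :* d :+ b :* c := c :* b :+ d :* a) refl a b c d)

  *-identityˡ : LeftIdentity _≡_ 𝟙 _*_
  *-identityˡ (a , b) = cong₂ _,_
    (solve 3 (λ a b δ → con 1 :* a :+ δ :* (con 0 :* b) := a) refl a b δ)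
    (solve 2 (λ a b → con 1 :* b :+ con 0 :* a := b) refl a b)

  *-distribʳ : _DistributesOverʳ_ _≡_ _*_ _+_
  *-distribʳ (e , f) (a , b) (c , d) = cong₂ _,_
    (solve 7 (λ a b c d e f δ →
       (a :+ c) :* e :+ δ :* ((b :+ d) :* f)
       := (a :* e :+ δ :* (b :* f)) :+ (c :* e :+ δ :* (d :* f))) refl a b c d e f δ)
    (solve 6 (λ a b c d e f →
       (a :+ c) :* f :+ (b :+ d) :* e
       := (a :* f :+ b :* e) :+ (c :* f :+ d :* e)) refl a b c d e f)

  *-zeroˡ : LeftZero _≡_ 𝟘 _*_
  *-zeroˡ (a , b) = cong₂ _,_
    (solve 3 (λ a b δ → con 0 :* a :+ δ :* (con 0 :* b) := con 0) refl a b δ)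
    (solve 2 (λ a b → con 0 :* b :+ con 0 :* a := con 0) refl a b)

  expand-α : ∀ x → expand α x ≡ x
  expand-α (a , b) = cong₂ _,_
    (solve 3 (λ a b δ → a :+ (b :* con 0 :+ δ :* (con 0 :* con 1)) := a) refl a b δ)
    (solve 1 (λ b → con 0 :+ (b :* con 1 :+ con 0 :* con 0) := b) refl b)

F289-commutativeSemiring : CommutativeSemiring _ _
F289-commutativeSemiring = commutativeSemiring-≡ _+_ _*_ 𝟘 𝟙
  +-assoc +-comm +-identityˡ *-assoc *-comm *-identityˡ *-distribʳ *-zeroˡ

open CommutativeSemiring F289-commutativeSemiring using (*-identityʳ)
open Solver F289-commutativeSemiring

ι-suc : ∀ n → ι (suc n) ≡ 𝟙 + ι n
ι-suc n = cong (_, zero) (fromℕ<-cong _ _ (begin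
  suc n % 17                   ≡⟨ %-distribˡ-+ 1 n 17 ⟩
  suc (n % 17) % 17            ≡⟨ cong (λ m → suc m % 17) (toℕ-fromℕ< (m%n<n n 17)) ⟨
  suc (toℕ (n mod 17)) % 17    ∎) _ _)
  where open ≡-Reasoning

ι-toℕ : ∀ p → ι (toℕ p) ≡ (p , zero)
ι-toℕ p = cong (_, zero)
  (trans (fromℕ<-cong _ _ (m<n⇒m%n≡m (toℕ<n p)) _ (toℕ<n p)) (fromℕ<-toℕ p (toℕ<n p)))

-α : F289
-α = ι 16 * α

conj : F289 → F289
conj = expand -α

abstract
  x²≡δ⇒x≡±α : ∀ x → x * x ≡ ι 10 → x ≡ α ⊎ x ≡ -α
  x²≡δ⇒x≡±α = toWitness {a? = all-F289? λ x → x * x ≟ ι 10 →-dec (x ≟ α ⊎-dec x ≟ -α)} tt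

  conj-CB : map conj CB ≐ C (ι 16) (ι 5)
  conj-CB = toWitness {a? = map conj CB ≐? C (ι 16) (ι 5)} tt

module _ {v : F289 → F289} (gal : IsGal v) where
  private
    v-+ : ∀ x y → v (x + y) ≡ v x + v y
    v-+ = proj₁ (proj₂ gal)

    v-* : ∀ x y → v (x * y) ≡ v x * v y
    v-* = proj₁ (proj₂ (proj₂ gal))

    v-𝟙 : v 𝟙 ≡ 𝟙
    v-𝟙 = proj₂ (proj₂ (proj₂ gal))

  gal-fixes-ι-suc : ∀ n → v (ι (suc n)) ≡ ι (suc n)
  gal-fixes-ι-suc zero    = v-𝟙
  gal-fixes-ι-suc (suc n) = begin
    v (ι (suc (suc n)))       ≡⟨ cong v (ι-suc (suc n)) ⟩
    v (𝟙 + ι (suc n))         ≡⟨ v-+ 𝟙 (ι (suc n)) ⟩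
    v 𝟙 + v (ι (suc n))       ≡⟨ cong₂ _+_ v-𝟙 (gal-fixes-ι-suc n) ⟩
    𝟙 + ι (suc n)             ≡⟨ ι-suc (suc n) ⟨
    ι (suc (suc n))           ∎
    where open ≡-Reasoning

  -- ι 0 and ι 17 are the same element.
  gal-fixes-ι : ∀ n → v (ι n) ≡ ι n
  gal-fixes-ι zero    = gal-fixes-ι-suc 16
  gal-fixes-ι (suc n) = gal-fixes-ι-suc n

  gal-fixes-F17 : ∀ p → v (p , zero) ≡ (p , zero)
  gal-fixes-F17 p = subst (λ x → v x ≡ x) (ι-toℕ p) (gal-fixes-ι (toℕ p))

  gal-expand : ∀ x → v x ≡ expand (v α) x
  gal-expand (a , b) = begin
    v (a , b)                             ≡⟨ cong v (expand-α (a , b)) ⟨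
    v ((a , zero) + (b , zero) * α)       ≡⟨ v-+ _ _ ⟩
    v (a , zero) + v ((b , zero) * α)     ≡⟨ cong (v (a , zero) +_) (v-* _ _) ⟩
    v (a , zero) + v (b , zero) * v α     ≡⟨ cong₂ (λ p q → p + q * v α) (gal-fixes-F17 a) (gal-fixes-F17 b) ⟩
    expand (v α) (a , b)                  ∎
    where open ≡-Reasoning

  gal-α : v α ≡ α ⊎ v α ≡ -α
  gal-α = x²≡δ⇒x≡±α (v α) (trans (sym (v-* α α)) (gal-fixes-ι 10))

  gal≗id⊎conj : (∀ x → v x ≡ x) ⊎ (∀ x → v x ≡ conj x)
  gal≗id⊎conj with gal-α
  ... | inj₁ vα≡α  = inj₁ λ x →
    trans (gal-expand x) (trans (cong (λ w → expand w x) vα≡α) (expand-α x))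
  ... | inj₂ vα≡-α = inj₂ λ x →
    trans (gal-expand x) (cong (λ w → expand w x) vα≡-α)

affine : F289 → F289 → F289 → F289
affine s γ x = s * x + γ

affine-∘ : ∀ a b s γ x → affine a b (affine s γ x) ≡ affine (a * s) (a * γ + b) x
affine-∘ = solve 5 (λ a b s γ x → a :* (s :* x :+ γ) :+ b := (a :* s) :* x :+ (a :* γ :+ b)) refl

map-affine-C : ∀ a b s γ → map (affine a b) (C s γ) ≡ C (a * s) (a * γ + b)
map-affine-C a b s γ =
  trans (sym (map-∘ {g = affine a b} {f = affine s γ} CB)) (map-cong (affine-∘ a b s γ) CB)

square-distrib-* : ∀ x y → (x * y) * (x * y) ≡ (x * x) * (y * y)
square-distrib-* = solve 2 (λ x y → (x :* y) :* (x :* y) := (x :* x) :* (y :* y)) refl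

S-*-square : ∀ {a} y y⁻¹ → y⁻¹ * y ≡ 𝟙 → S a → S (a * (y * y))
S-*-square {a} y y⁻¹ y⁻¹y≡𝟙 (a≢𝟘 , z , z²≡a) = a·y²≢𝟘 , z * y , z·y²≡a·y²
  where
  open ≡-Reasoning

  a·y²≢𝟘 : ¬ a * (y * y) ≡ 𝟘
  a·y²≢𝟘 a·y²≡𝟘 = a≢𝟘 (begin
    a                                   ≡⟨ *-identityʳ a ⟨
    a * (𝟙 * 𝟙)                         ≡⟨ cong (λ u → a * (u * u)) y⁻¹y≡𝟙 ⟨
    a * ((y⁻¹ * y) * (y⁻¹ * y))         ≡⟨ cong (a *_) (square-distrib-* y⁻¹ y) ⟩
    a * ((y⁻¹ * y⁻¹) * (y * y))         ≡⟨ cong (a *_) (*-comm (y⁻¹ * y⁻¹) (y * y)) ⟩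
    a * ((y * y) * (y⁻¹ * y⁻¹))         ≡⟨ *-assoc a _ _ ⟨
    (a * (y * y)) * (y⁻¹ * y⁻¹)         ≡⟨ cong (_* (y⁻¹ * y⁻¹)) a·y²≡𝟘 ⟩
    𝟘 * (y⁻¹ * y⁻¹)                     ≡⟨ *-zeroˡ (y⁻¹ * y⁻¹) ⟩
    𝟘                                   ∎)

  z·y²≡a·y² : (z * y) * (z * y) ≡ a * (y * y)
  z·y²≡a·y² = trans (square-distrib-* z y) (cong (_* (y * y)) z²≡a)

Aut-image-CB : ∀ (σ : F289 → F289) → IsAut σ →
               Σ F289 λ s → Σ F289 λ γ → S s × (map σ CB ≐ C s γ)
Aut-image-CB σ (a , b , v , Sa , gal , σ≡) with gal≗id⊎conj gal
... | inj₁ v≗id   = a , b , Sa , ≡⇒≐ σCB≡Cab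
  where
  σCB≡Cab : map σ CB ≡ C a b
  σCB≡Cab = map-cong (λ x → trans (σ≡ x) (cong (affine a b) (v≗id x))) CB
-- ι 16 = ι 4 * ι 4 is −1, and ι 13 * ι 4 = 𝟙.
... | inj₂ v≗conj = a * ι 16 , a * ι 5 + b , S-*-square (ι 4) (ι 13) refl Sa ,
    subst₂ _≐_ (sym σCB≡ab[conjCB]) (map-affine-C a b (ι 16) (ι 5)) (≐-map⁺ (affine a b) conj-CB)
  where
  σCB≡ab[conjCB] : map σ CB ≡ map (affine a b) (map conj CB)
  σCB≡ab[conjCB] = trans (map-cong (λ x → trans (σ≡ x) (cong (affine a b) (v≗conj x))) CB)
                         (map-∘ {g = affine a b} {f = conj} CB)

id-isGal : IsGal id
id-isGal = bijective _≡_ , (λ _ _ → refl) , (λ _ _ → refl) , refl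

lemma3p10 : (∀ (σ : F289 → F289) → IsAut σ →
              Σ F289 λ s → Σ F289 λ γ → S s × (map σ CB ≐ C s γ))
            × (∀ (s γ : F289) → S s →
              Σ (F289 → F289) λ σ → IsAut σ × (map σ CB ≐ C s γ))
lemma3p10 = Aut-image-CB , λ s γ Ss →
  affine s γ , (s , γ , id , Ss , id-isGal , λ _ → refl) , ≡⇒≐ refl
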